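{- The solver $SAT_{\mathcal{RQ}}$ can be implemented so as to terminate on every conjunction of pure $\Phi_\forall$ constraints, i.e. on every finite conjunction of constraints of the form $foreach(x_1\in A_1, foreach(x_2\in A_2,\dots foreach(x_n\in A_n,\phi)\dots))$ with $n\ge1$, $x_i$ control terms, $A_i$ extensional set terms and $\phi$ an $\mathcal{X}$-formula.
   Context: Setting. $\mathcal{X}$ is a first-order theory with a class of admissible (quantifier-free) $\mathcal{X}$-formulas built from function symbols $\mathcal{F}_\mathcal{X}$ (including a binary pairing symbol) and predicate symbols $\Pi_\mathcal{X}$ (including $=_\mathcal{X}$), with a decision procedure $SAT_\mathcal{X}$. Standing assumptions: set variables and element variables are disjoint sorts, and $\Pi_\mathcal{X}$ is disjoint from the set predicates $=_\mathcal{S},\in,\subseteq$. In $\mathcal{L}_{\mathcal{RQ}}(\mathcal{X})$: control terms are element variables or nested pairs of control terms (distinct variables); extensional set terms are $\varnothing$, set variables, and $\{e\sqcup E\}$ (meaning $\{e\}\cup E$); RIS terms $\{c:D\mid\phi\}$ denote the instances of $c$ in $D$ satisfying $\phi$. $foreach(c\in A,\phi)$ abbreviates $A\subseteq\{c:A\mid\phi\}$; $exists(c\in A,\phi)$ abbreviates $n\in A\land\phi(n)$ with $n$ fresh. Solver $SAT_{\mathcal{RQ}}$: repeatedly applies the following non-deterministic rewrite rules to set constraints until a fixpoint (first applicable rule in listed order; disjunctive right sides branch; $N$ fresh), then calls $SAT_\mathcal{X}$ on the $\mathcal{X}$-part. Rules ($\dot A$ a variable): $\varnothing\subseteq\{x:\varnothing\mid\phi\}\to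 true$; $\{a\sqcup A\}\subseteq\{x:\{a\sqcup A\}\mid\phi(x)\}\to\phi(a)\land A\subseteq\{x:A\mid\phi(x)\}$; $\dot A\subseteq\{x:\dot A\mid\phi\}$ irreducible; $a\in\varnothing\to false$; $a\in\{b\sqcup A\}\to a=_\mathcal{X}b\lor a\in A$; $a\in\dot A\to\dot A=\{a\sqcup N\}$; $\varnothing=\varnothing\to true$; $\dot A=\dot A\to true$; $B=\dot A\to\dot A=B$ if $B$ not a variable; $\dot A=B\to\dot A=B$ and substitute $B$ for $\dot A$ elsewhere; $\{a\sqcup A\}=\varnothing\to false$; $\varnothing=\{a\sqcup A\}\to false$; $\{a\sqcup A\}=\{b\sqcup B\}\to(a=_\mathcal{X}b\land A=B)\lor(a=_\mathcal{X}b\land\{a\sqcup A\}=B)\lor(a=_\mathcal{X}b\land A=\{b\sqcup B\})\lor(A=\{b\sqcup N\}\land B=\{a\sqcup N\})$; $\dot A=B$ irreducible if $\dot A$ occurs nowhere else. "Terminates" means every non-deterministic computation branch terminates. -}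

module Defs where

open import Data.Nat using (ℕ; _≟_)
open import Data.Bool using (if_then_else_)
open import Data.Product using (_×_; _,_)
open import Data.List using (List; []; _∷_; _++_; length; zip)
open import Data.List.Relation.Unary.All using (All)
open import Data.List.Relation.Unary.Unique.Propositional using (Unique)
open import Data.List.Membership.Propositional using (_∈_; _∉_)
open import Data.List.Membership.DecPropositional _≟_ using (_∈?_)
open import Relation.Nullary using (¬_; does)
open import Relation.Binary.PropositionalEquality using (_≡_; _≢_)
open import Induction.WellFounded using (Acc)

data Term (F : Set) : Set where
  var  : ℕ → Term F
  pair : Term F → Term F → Term F
  app  : F → List (Term F) → Term F

data XForm (F P : Set) : Set where
  trueX falseX : XForm F P
  eqX  : Term F → Term F → XForm F P
  predX : P → List (Term F) → XForm F P
  andX orX : XForm F P → XForm F P → XForm F P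
  notX : XForm F P → XForm F P

data CTerm : Set where
  cvar  : ℕ → CTerm
  cpair : CTerm → CTerm → CTerm

ctVars : CTerm → List ℕ
ctVars (cvar x)    = x ∷ []
ctVars (cpair c d) = ctVars c ++ ctVars d

ctTerm : ∀ {F} → CTerm → Term F
ctTerm (cvar x)    = var x
ctTerm (cpair c d) = pair (ctTerm c) (ctTerm d)

-- extensional set terms: ∅, set variables, {e ⊔ E}
data STerm (F : Set) : Set where
  ∅    : STerm F
  svar : ℕ → STerm F
  ins  : Term F → STerm F → STerm F

data IsSVar {F : Set} : STerm F → Set where
  is-svar : ∀ n → IsSVar (svar n)

-- atomic constraints; a formula / conjunction is a List of atoms
data Atom (F P : Set) : Set where
  xc  : XForm F P → Atom F P
  sub : STerm F → CTerm → STerm F → List (Atom F P) → Atom F P -- A ⊆ {c : D | φ}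
  mem : Term F → STerm F → Atom F P
  seq : STerm F → STerm F → Atom F P

foreach : ∀ {F P} → CTerm → STerm F → List (Atom F P) → Atom F P
foreach c A φ = sub A c A φ

-- Substitution of an element term for an element variable
-- (the variables of a control term are bound in the RIS filter only)

module _ {F P : Set} where

  mutual
    substT : ℕ → Term F → Term F → Term F
    substT x a (var y)    = if does (x ≟ y) then a else var y
    substT x a (pair s t) = pair (substT x a s) (substT x a t)
    substT x a (app f ts) = app f (substTs x a ts)

    substTs : ℕ → Term F → List (Term F) → List (Term F)
    substTs x a []       = []
    substTs x a (t ∷ ts) = substT x a t ∷ substTs x a ts

  substX : ℕ → Term F → XForm F P → XForm F P
  substX x a trueX       = trueX
  substX x a falseX      = falseX
  substX x a (eqX s t)   = eqX (substT x a s) (substT x a t)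
  substX x a (predX p ts) = predX p (substTs x a ts)
  substX x a (andX f g)  = andX (substX x a f) (substX x a g)
  substX x a (orX f g)   = orX (substX x a f) (substX x a g)
  substX x a (notX f)    = notX (substX x a f)

  substS : ℕ → Term F → STerm F → STerm F
  substS x a ∅         = ∅
  substS x a (svar n)  = svar n
  substS x a (ins t A) = ins (substT x a t) (substS x a A)

  mutual
    substA : ℕ → Term F → Atom F P → Atom F P
    substA x a (xc f)        = xc (substX x a f)
    substA x a (sub A c D φ) =
      sub (substS x a A) c (substS x a D)
          (if does (x ∈? ctVars c) then φ else substAs x a φ)
    substA x a (mem t A)     = mem (substT x a t) (substS x a A)
    substA x a (seq A B)     = seq (substS x a A) (substS x a B)

    substAs : ℕ → Term F → List (Atom F P) → List (Atom F P)
    substAs x a []       = []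
    substAs x a (b ∷ bs) = substA x a b ∷ substAs x a bs

  renameAs : List (ℕ × ℕ) → List (Atom F P) → List (Atom F P)
  renameAs []             φ = φ
  renameAs ((x , y) ∷ ρ) φ = renameAs ρ (substAs x (var y) φ)

  renVar : List (ℕ × ℕ) → ℕ → ℕ
  renVar []             z = z
  renVar ((x , y) ∷ ρ) z = if does (x ≟ z) then y else renVar ρ z

  renameCT : List (ℕ × ℕ) → CTerm → CTerm
  renameCT ρ (cvar x)    = cvar (renVar ρ x)
  renameCT ρ (cpair c d) = cpair (renameCT ρ c) (renameCT ρ d)

  ssubstS : ℕ → STerm F → STerm F → STerm F
  ssubstS n B ∅         = ∅
  ssubstS n B (svar m)  = if does (n ≟ m) then B else svar m
  ssubstS n B (ins t A) = ins t (ssubstS n B A)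

  mutual
    ssubstA : ℕ → STerm F → Atom F P → Atom F P
    ssubstA n B (xc f)        = xc f
    ssubstA n B (sub A c D φ) = sub (ssubstS n B A) c (ssubstS n B D) (ssubstAs n B φ)
    ssubstA n B (mem t A)     = mem t (ssubstS n B A)
    ssubstA n B (seq A C)     = seq (ssubstS n B A) (ssubstS n B C)

    ssubstAs : ℕ → STerm F → List (Atom F P) → List (Atom F P)
    ssubstAs n B []       = []
    ssubstAs n B (b ∷ bs) = ssubstA n B b ∷ ssubstAs n B bs

  -- Variable occurrences (free or bound), used for freshness

  mutual
    evarsT : Term F → List ℕ
    evarsT (var y)    = y ∷ []
    evarsT (pair s t) = evarsT s ++ evarsT t
    evarsT (app f ts) = evarsTs ts

    evarsTs : List (Term F) → List ℕ
    evarsTs []       = []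
    evarsTs (t ∷ ts) = evarsT t ++ evarsTs ts

  evarsX : XForm F P → List ℕ
  evarsX trueX        = []
  evarsX falseX       = []
  evarsX (eqX s t)    = evarsT s ++ evarsT t
  evarsX (predX p ts) = evarsTs ts
  evarsX (andX f g)   = evarsX f ++ evarsX g
  evarsX (orX f g)    = evarsX f ++ evarsX g
  evarsX (notX f)     = evarsX f

  evarsS : STerm F → List ℕ
  evarsS ∅         = []
  evarsS (svar n)  = []
  evarsS (ins t A) = evarsT t ++ evarsS A

  svarsS : STerm F → List ℕ
  svarsS ∅         = []
  svarsS (svar n)  = n ∷ []
  svarsS (ins t A) = svarsS A

  mutual
    evarsA : Atom F P → List ℕ
    evarsA (xc f)        = evarsX f
    evarsA (sub A c D φ) = evarsS A ++ ctVars c ++ evarsS D ++ evarsAs φ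
    evarsA (mem t A)     = evarsT t ++ evarsS A
    evarsA (seq A B)     = evarsS A ++ evarsS B

    evarsAs : List (Atom F P) → List ℕ
    evarsAs []       = []
    evarsAs (b ∷ bs) = evarsA b ++ evarsAs bs

  mutual
    svarsA : Atom F P → List ℕ
    svarsA (xc f)        = []
    svarsA (sub A c D φ) = svarsS A ++ svarsS D ++ svarsAs φ
    svarsA (mem t A)     = svarsS A
    svarsA (seq A B)     = svarsS A ++ svarsS B

    svarsAs : List (Atom F P) → List ℕ
    svarsAs []       = []
    svarsAs (b ∷ bs) = svarsA b ++ svarsAs bs

  -- φ(a): instantiating the filter of {c : D | φ} with the element a.
  -- c a variable x: φ[a/x].  c a (nested) pair: a =_X c' ∧ φ[c'/c] where
  -- c' is a copy of c with the fresh variables ys.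

  instPair : CTerm → List ℕ → Term F → List (Atom F P) → List (Atom F P)
  instPair c ys a φ =
    xc (eqX a (ctTerm (renameCT (zip (ctVars c) ys) c))) ∷ renameAs (zip (ctVars c) ys) φ

  -- The rewrite rules of SAT_RQ applied to one atom of the state Γ.
  -- `Rule Γ α δ` : atom α (occurring in Γ) is rewritten to the conjunction δ
  -- (one constructor per disjunct; rules are mutually exclusive, which encodes
  -- "first applicable rule").  Irreducible atoms have no rule.

  data Rule (Γ : List (Atom F P)) : Atom F P → List (Atom F P) → Set where
    sub-∅ : ∀ {c φ} → Rule Γ (sub ∅ c ∅ φ) []
    sub-ins-var : ∀ {a A x φ} →
      Rule Γ (sub (ins a A) (cvar x) (ins a A) φ)
             (substAs x a φ ++ sub A (cvar x) A φ ∷ [])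
    sub-ins-pair : ∀ {a A c d φ} (ys : List ℕ) →
      Unique ys → All (_∉ evarsAs Γ) ys →
      length ys ≡ length (ctVars (cpair c d)) →
      Rule Γ (sub (ins a A) (cpair c d) (ins a A) φ)
             (instPair (cpair c d) ys a φ ++ sub A (cpair c d) A φ ∷ [])
    mem-∅ : ∀ {a} → Rule Γ (mem a ∅) (xc falseX ∷ [])
    mem-ins₁ : ∀ {a b A} → Rule Γ (mem a (ins b A)) (xc (eqX a b) ∷ [])
    mem-ins₂ : ∀ {a b A} → Rule Γ (mem a (ins b A)) (mem a A ∷ [])
    mem-var : ∀ {a n} (N : ℕ) → N ∉ svarsAs Γ →
      Rule Γ (mem a (svar n)) (seq (svar n) (ins a (svar N)) ∷ [])
    seq-∅∅ : Rule Γ (seq ∅ ∅) []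
    seq-vv : ∀ {n} → Rule Γ (seq (svar n) (svar n)) []
    seq-flip : ∀ {B n} → ¬ IsSVar B → Rule Γ (seq B (svar n)) (seq (svar n) B ∷ [])
    seq-ins-∅ : ∀ {a A} → Rule Γ (seq (ins a A) ∅) (xc falseX ∷ [])
    seq-∅-ins : ∀ {a A} → Rule Γ (seq ∅ (ins a A)) (xc falseX ∷ [])
    seq-ins₁ : ∀ {a A b B} → Rule Γ (seq (ins a A) (ins b B))
                 (xc (eqX a b) ∷ seq A B ∷ [])
    seq-ins₂ : ∀ {a A b B} → Rule Γ (seq (ins a A) (ins b B))
                 (xc (eqX a b) ∷ seq (ins a A) B ∷ [])
    seq-ins₃ : ∀ {a A b B} → Rule Γ (seq (ins a A) (ins b B))
                 (xc (eqX a b) ∷ seq A (ins b B) ∷ [])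
    seq-ins₄ : ∀ {a A b B} (N : ℕ) → N ∉ svarsAs Γ →
      Rule Γ (seq (ins a A) (ins b B))
             (seq A (ins b (svar N)) ∷ seq B (ins a (svar N)) ∷ [])

  data _⟶_ : List (Atom F P) → List (Atom F P) → Set where
    local : ∀ Γ₁ α Γ₂ δ → Rule (Γ₁ ++ α ∷ Γ₂) α δ →
      (Γ₁ ++ α ∷ Γ₂) ⟶ (Γ₁ ++ δ ++ Γ₂)
    elim : ∀ Γ₁ n B Γ₂ → B ≢ svar n → n ∈ svarsAs (Γ₁ ++ Γ₂) →
      (Γ₁ ++ seq (svar n) B ∷ Γ₂) ⟶
      (ssubstAs n B Γ₁ ++ seq (svar n) B ∷ ssubstAs n B Γ₂)

  -- Every non-deterministic computation branch from Γ is finite.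
  Terminates : List (Atom F P) → Set
  Terminates Γ = Acc (λ Δ Δ′ → Δ′ ⟶ Δ) Γ

  data PureBody : List (Atom F P) → Set where
    body-x : ∀ (f : XForm F P) → PureBody (xc f ∷ [])
    body-∀ : ∀ {A c φ} → Unique (ctVars c) → PureBody φ →
      PureBody (foreach c A φ ∷ [])

  data PureForall : Atom F P → Set where
    pure-∀ : ∀ {A c φ} → Unique (ctVars c) → PureBody φ →
      PureForall (foreach c A φ)

{-# OPTIONS --safe #-}
module Submission where

-- Everything the solver derives from pure Φ_∀ constraints consists of
-- X-constraints and RIS inclusions whose filters are again of this shape: the
-- instance φ(a) is a substitution instance of φ, so no membership or equality
-- atom ever arises and only the two ⊆-rules fire.  Weigh an inclusion with
-- domain D and filter φ by (1 + |D|)(1 + weight φ), |D| the number of listed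
-- elements of D.  Peeling a off D = {a ⊔ A} trades (2 + |A|)(1 + weight φ) for
-- weight φ(a) + (1 + |A|)(1 + weight φ), and substitution preserves weights,
-- so every step decreases the total weight.

open import Defs
open import Data.List using (List; []; _∷_; _++_; zip)
open import Data.List.Relation.Unary.All as All using (All; []; _∷_)
open import Data.List.Relation.Unary.All.Properties using (++⁺; ++⁻)
open import Data.Nat using (ℕ; suc; _≟_; _+_; _*_; _<_; s≤s; z≤n)
open import Data.List.Membership.DecPropositional _≟_ using (_∈?_)
open import Data.Nat.Properties using (+-assoc; +-identityʳ; ≤-refl; +-monoʳ-<; +-monoˡ-<)
open import Data.Nat.Induction using (<-wellFounded)
open import Data.Bool using (true; false)
open import Data.Product using (_×_; _,_)
open import Relation.Nullary using (does)
open import Relation.Binary.PropositionalEquality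
  using (_≡_; refl; cong; cong₂; sym; trans; subst₂; module ≡-Reasoning)
open import Induction.WellFounded using (Acc; acc)

accessible-by-invariant-measure :
  {A : Set} (_⟶_ : A → A → Set) (I : A → Set) (μ : A → ℕ) →
  (∀ {x y} → x ⟶ y → I x → I y × μ y < μ x) →
  ∀ x → I x → Acc (λ y x → x ⟶ y) x
accessible-by-invariant-measure _⟶_ I μ step x Ix = go x Ix (<-wellFounded (μ x))
  where
  go : ∀ x → I x → Acc _<_ (μ x) → Acc (λ y x → x ⟶ y) x
  go x Ix (acc rec) = acc λ x⟶y → let (Iy , μy<μx) = step x⟶y Ix in go _ Iy (rec μy<μx)

module _ {F P : Set} where

  size : STerm F → ℕ
  size ∅         = 0
  size (svar _)  = 0
  size (ins _ D) = suc (size D)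

  size-substS : ∀ x a D → size (substS {F} {P} x a D) ≡ size D
  size-substS x a ∅         = refl
  size-substS x a (svar _)  = refl
  size-substS x a (ins _ D) = cong suc (size-substS x a D)

  data Guarded : Atom F P → Set where
    xc  : ∀ f → Guarded (xc f)
    sub : ∀ {A c D φ} → All Guarded φ → Guarded (sub A c D φ)

  mutual
    weight : Atom F P → ℕ
    weight (sub _ _ D φ) = suc (size D) * suc (weights φ)
    weight _             = 0

    weights : List (Atom F P) → ℕ
    weights []       = 0
    weights (α ∷ Γ) = weight α + weights Γ

  weights-++ : ∀ Γ Δ → weights (Γ ++ Δ) ≡ weights Γ + weights Δ
  weights-++ []      Δ = refl
  weights-++ (α ∷ Γ) Δ = trans (cong (weight α +_) (weights-++ Γ Δ))
                               (sym (+-assoc (weight α) (weights Γ) (weights Δ)))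

  mutual
    substA-guarded : ∀ x a {α} → Guarded α → Guarded (substA x a α)
    substA-guarded x a (xc f) = xc (substX x a f)
    substA-guarded x a (sub {c = c} gφ) with does (x ∈? ctVars c)
    ... | true  = sub gφ
    ... | false = sub (substAs-guarded x a gφ)

    substAs-guarded : ∀ x a {Γ} → All Guarded Γ → All Guarded (substAs x a Γ)
    substAs-guarded x a []       = []
    substAs-guarded x a (g ∷ gs) = substA-guarded x a g ∷ substAs-guarded x a gs

  mutual
    weight-substA : ∀ x a α → weight (substA x a α) ≡ weight α
    weight-substA x a (xc _)        = refl
    weight-substA x a (mem _ _)     = refl
    weight-substA x a (seq _ _)     = refl
    weight-substA x a (sub A c D φ) with does (x ∈? ctVars c)
    ... | true  = cong (λ s → suc s * suc (weights φ)) (size-substS x a D)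
    ... | false = cong₂ (λ s w → suc s * suc w) (size-substS x a D) (weights-substAs x a φ)

    weights-substAs : ∀ x a Γ → weights (substAs x a Γ) ≡ weights Γ
    weights-substAs x a []      = refl
    weights-substAs x a (α ∷ Γ) = cong₂ _+_ (weight-substA x a α) (weights-substAs x a Γ)

  renameAs-guarded : ∀ ρ {Γ} → All Guarded Γ → All Guarded (renameAs ρ Γ)
  renameAs-guarded []            g = g
  renameAs-guarded ((x , y) ∷ ρ) g = renameAs-guarded ρ (substAs-guarded x (var y) g)

  weights-renameAs : ∀ ρ Γ → weights (renameAs ρ Γ) ≡ weights Γ
  weights-renameAs []            Γ = refl
  weights-renameAs ((x , y) ∷ ρ) Γ =
    trans (weights-renameAs ρ (substAs x (var y) Γ)) (weights-substAs x (var y) Γ)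

  peel-decreases : ∀ {a A c φ} → All Guarded φ → ∀ ψ → All Guarded ψ → weights ψ ≡ weights φ →
    All Guarded (ψ ++ sub A c A φ ∷ []) ×
    weights (ψ ++ sub A c A φ ∷ []) < weight (sub (ins a A) c (ins a A) φ)
  peel-decreases {A = A} {c} {φ} gφ ψ gψ ψ≈φ =
    ++⁺ gψ (sub gφ ∷ []) , subst₂ _<_ (sym total) refl ≤-refl
    where
    open ≡-Reasoning
    total : weights (ψ ++ sub A c A φ ∷ []) ≡ weights φ + suc (size A) * suc (weights φ)
    total = begin
      weights (ψ ++ sub A c A φ ∷ [])         ≡⟨ weights-++ ψ _ ⟩
      weights ψ + (weight (sub A c A φ) + 0)   ≡⟨ cong₂ _+_ ψ≈φ (+-identityʳ _) ⟩
      weights φ + suc (size A) * suc (weights φ) ∎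

  rule-decreases : ∀ {Γ α δ} → Rule Γ α δ → Guarded α → All Guarded δ × weights δ < weight α
  rule-decreases sub-∅ _ = [] , s≤s z≤n
  rule-decreases (sub-ins-var {a} {A} {x} {φ}) (sub gφ) =
    peel-decreases {a} {A} gφ (substAs x a φ) (substAs-guarded x a gφ) (weights-substAs x a φ)
  rule-decreases (sub-ins-pair {a} {A} {c} {d} {φ} ys _ _ _) (sub gφ) =
    peel-decreases {a} {A} gφ (instPair (cpair c d) ys a φ)
      (xc _ ∷ renameAs-guarded ρ gφ) (weights-renameAs ρ φ)
    where ρ = zip (ctVars (cpair c d)) ys
  rule-decreases mem-∅           ()
  rule-decreases mem-ins₁        ()
  rule-decreases mem-ins₂        ()
  rule-decreases (mem-var _ _)   ()
  rule-decreases seq-∅∅          ()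
  rule-decreases seq-vv          ()
  rule-decreases (seq-flip _)    ()
  rule-decreases seq-ins-∅       ()
  rule-decreases seq-∅-ins       ()
  rule-decreases seq-ins₁        ()
  rule-decreases seq-ins₂        ()
  rule-decreases seq-ins₃        ()
  rule-decreases (seq-ins₄ _ _)  ()

  step-decreases : ∀ {Γ Δ} → Γ ⟶ Δ → All Guarded Γ → All Guarded Δ × weights Δ < weights Γ
  step-decreases (local Γ₁ α Γ₂ δ r) g with ++⁻ Γ₁ g
  ... | g₁ , gα ∷ g₂ with rule-decreases r gα
  ...   | gδ , δ<α = ++⁺ g₁ (++⁺ gδ g₂) , subst₂ _<_ (sym weights-after) (sym (weights-++ Γ₁ _))
                       (+-monoʳ-< (weights Γ₁) (+-monoˡ-< (weights Γ₂) δ<α))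
    where
    weights-after : weights (Γ₁ ++ δ ++ Γ₂) ≡ weights Γ₁ + (weights δ + weights Γ₂)
    weights-after = trans (weights-++ Γ₁ (δ ++ Γ₂)) (cong (weights Γ₁ +_) (weights-++ δ Γ₂))
  step-decreases (elim Γ₁ _ _ _ _ _) g with ++⁻ Γ₁ g
  ... | _ , () ∷ _

  pureBody-guarded : ∀ {φ} → PureBody φ → All Guarded φ
  pureBody-guarded (body-x f)   = xc f ∷ []
  pureBody-guarded (body-∀ _ b) = sub (pureBody-guarded b) ∷ []

  pureForall-guarded : ∀ {α} → PureForall α → Guarded α
  pureForall-guarded (pure-∀ _ b) = sub (pureBody-guarded b)

theorem3 : {F P : Set} (Γ : List (Atom F P)) → All PureForall Γ → Terminates Γ
theorem3 Γ pure =
  accessible-by-invariant-measure _⟶_ (All Guarded) weights step-decreases Γ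
    (All.map pureForall-guarded pure)
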